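{- Let $\mathrm{Rec}$ be the model over $\mathbb N$ consisting of all total recursive functions $\mathbb N\to\mathbb N$, and let $\mathrm{Prim}$ be the model over $\mathbb N$ consisting of all primitive recursive functions $\mathbb N\to\mathbb N$. Then $\mathrm{Rec}\succ\mathrm{Prim}$; that is, $\mathrm{Rec}\succsim\mathrm{Prim}$, but there is no injection $\rho:\mathbb N\to\mathbb N$ with $\mathrm{Prim}\succsim_\rho\mathrm{Rec}$.
   Context: A model of computation over a set $D$ is any set of functions $f:D\to D\cup\{\bot\}$, where $\bot$ denotes "undefined"; $\mathrm{dom}\,A$ denotes the domain of a model $A$. An encoding is an injection $\rho:\mathrm{dom}\,B\to\mathrm{dom}\,A$, extended by $\rho(\bot)=\bot$. Model $A$ simulates model $B$ via $\rho$, written $A\succsim_\rho B$, if for every $g\in B$ there is $f\in A$ with $\rho\circ g=f\circ\rho$ (as functions on $\mathrm{dom}\,B$). $A\succsim B$ means $A\succsim_\rho B$ for some injection $\rho$; $A\succ B$ means $A\succsim B$ and not $B\succsim A$. -}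

module Defs where

open import Data.Nat using (ℕ; zero; suc; _<_)
open import Data.Fin using (Fin)
open import Data.Vec using (Vec; []; _∷_; lookup; [_])
open import Data.Maybe using (Maybe; just; nothing)
open import Data.Product using (Σ; _×_; _,_; ∃)
open import Relation.Binary.PropositionalEquality using (_≡_)
open import Relation.Nullary using (¬_)
open import Function.Definitions using (Injective)

-- A model over D is a set of functions D → D ∪ {⊥}, i.e. a predicate on them.
Model : Set → Set₁
Model D = (D → Maybe D) → Set

ext : {D E : Set} → (D → E) → Maybe D → Maybe E
ext ρ (just x) = just (ρ x)
ext ρ nothing  = nothing

SimulatesVia : {DA DB : Set} → Model DA → Model DB → (DB → DA) → Set
SimulatesVia {DA} {DB} A B ρ =
  (g : DB → Maybe DB) → B g →
  Σ (DA → Maybe DA) λ f → A f × ((x : DB) → ext ρ (g x) ≡ f (ρ x))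

Simulates : {DA DB : Set} → Model DA → Model DB → Set
Simulates {DA} {DB} A B =
  Σ (DB → DA) λ ρ → Injective _≡_ _≡_ ρ × SimulatesVia A B ρ

StrictlySimulates : {DA DB : Set} → Model DA → Model DB → Set
StrictlySimulates A B = Simulates A B × ¬ Simulates B A

data PR : ℕ → Set where
  zeroᶠ : PR 0
  succᶠ : PR 1
  proj  : ∀ {n} → Fin n → PR n
  comp  : ∀ {k n} → PR k → Vec (PR n) k → PR n
  prec  : ∀ {n} → PR n → PR (suc (suc n)) → PR (suc n)

mutual
  evalPR : ∀ {n} → PR n → Vec ℕ n → ℕ
  evalPR zeroᶠ      xs = zero
  evalPR succᶠ      (x ∷ []) = suc x
  evalPR (proj i)   xs = lookup xs i
  evalPR (comp f gs) xs = evalPR f (evalPR* gs xs)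
  evalPR (prec g h) (zero ∷ xs)  = evalPR g xs
  evalPR (prec g h) (suc m ∷ xs) = evalPR h (m ∷ evalPR (prec g h) (m ∷ xs) ∷ xs)

  evalPR* : ∀ {k n} → Vec (PR n) k → Vec ℕ n → Vec ℕ k
  evalPR* []       xs = []
  evalPR* (g ∷ gs) xs = evalPR g xs ∷ evalPR* gs xs

IsPrimRec : (ℕ → ℕ) → Set
IsPrimRec f = Σ (PR 1) λ c → (x : ℕ) → evalPR c [ x ] ≡ f x

data MR : ℕ → Set where
  zeroᶠ : MR 0
  succᶠ : MR 1
  proj  : ∀ {n} → Fin n → MR n
  comp  : ∀ {k n} → MR k → Vec (MR n) k → MR n
  prec  : ∀ {n} → MR n → MR (suc (suc n)) → MR (suc n)
  mu    : ∀ {n} → MR (suc n) → MR n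

mutual
  data _⇓[_]_ : ∀ {n} → MR n → Vec ℕ n → ℕ → Set where
    zero⇓  : zeroᶠ ⇓[ [] ] zero
    succ⇓  : ∀ {x} → succᶠ ⇓[ x ∷ [] ] suc x
    proj⇓  : ∀ {n} {i : Fin n} {xs} → proj i ⇓[ xs ] lookup xs i
    comp⇓  : ∀ {k n} {f : MR k} {gs : Vec (MR n) k} {xs ys v} →
             gs ⇓*[ xs ] ys → f ⇓[ ys ] v → comp f gs ⇓[ xs ] v
    prec0⇓ : ∀ {n} {g : MR n} {h xs v} →
             g ⇓[ xs ] v → prec g h ⇓[ zero ∷ xs ] v
    precS⇓ : ∀ {n} {g : MR n} {h m xs r v} →
             prec g h ⇓[ m ∷ xs ] r → h ⇓[ m ∷ r ∷ xs ] v →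
             prec g h ⇓[ suc m ∷ xs ] v
    mu⇓    : ∀ {n} {c : MR (suc n)} {xs m} →
             c ⇓[ m ∷ xs ] zero →
             ((j : ℕ) → j < m → ∃ λ k → c ⇓[ j ∷ xs ] suc k) →
             mu c ⇓[ xs ] m

  data _⇓*[_]_ : ∀ {k n} → Vec (MR n) k → Vec ℕ n → Vec ℕ k → Set where
    []⇓ : ∀ {n} {xs : Vec ℕ n} → [] ⇓*[ xs ] []
    ∷⇓  : ∀ {k n} {g : MR n} {gs : Vec (MR n) k} {xs y ys} →
          g ⇓[ xs ] y → gs ⇓*[ xs ] ys → (g ∷ gs) ⇓*[ xs ] (y ∷ ys)

IsTotalRec : (ℕ → ℕ) → Set
IsTotalRec f = Σ (MR 1) λ c → (x : ℕ) → c ⇓[ [ x ] ] f x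

Rec : Model ℕ
Rec g = Σ (ℕ → ℕ) λ h → IsTotalRec h × ((x : ℕ) → g x ≡ just (h x))

Prim : Model ℕ
Prim g = Σ (ℕ → ℕ) λ h → IsPrimRec h × ((x : ℕ) → g x ≡ just (h x))

module Submission where

-- Rec simulates Prim through the identity, since primitive recursive codes are μ-recursive codes.
-- Conversely, suppose Prim simulated Rec via an injective ρ. Simulating the successor gives a
-- primitive recursive f with ρ (1 + x) = f (ρ x), so ρ is itself primitive recursive. Being
-- injective, ρ is unbounded, so h x = min { m | ack x x ≤ ρ m } is a total recursive μ-search,
-- and simulating h makes ρ ∘ h primitive recursive. But every primitive recursive function is
-- majorised by a branch ack k of the Ackermann function, whereas ρ (h k) ≥ ack k k.
-- That ack is total recursive is shown by μ-searching for the halting time of a stack machine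
-- computing it, arithmetised through Cantor pairing.

open import Defs
open import Data.Empty using (⊥-elim)
open import Data.Fin using (Fin; toℕ; fromℕ<) renaming (zero to fzero; suc to fsuc)
open import Data.Fin.Properties using (injective⇒≤; toℕ-fromℕ<; toℕ<n; toℕ-injective)
open import Data.List using (List; []; _∷_)
open import Data.Maybe using (Maybe; just; nothing)
open import Data.Maybe.Properties using (just-injective)
open import Data.Nat
  using (ℕ; zero; suc; pred; _+_; _∸_; _⊔_; _≤_; _<_; _≤′_; ≤′-reflexive; ≤′-step; _≤?_; _≟_; z≤n; s≤s; z<s; s<s)
open import Data.Nat.GeneralisedArithmetic using (fold; fold-+; +-is-fold)
open import Data.Nat.Properties
open import Data.Product using (∃; _×_; _,_; proj₁; proj₂)
open import Data.Sum using (_⊎_; inj₁; inj₂; [_,_]′)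
open import Data.Vec using (Vec; []; _∷_; head; tail; lookup; [_]; tabulate)
open import Data.Vec.Properties using (tabulate∘lookup)
open import Function using (id; _∘_)
open import Function.Definitions using (Injective)
open import Relation.Binary.Definitions using (tri<; tri≈; tri>)
open import Relation.Binary.PropositionalEquality hiding ([_])
open import Relation.Nullary using (¬_; yes; no)
open import Relation.Unary using (Decidable)

open ≡-Reasoning

record Least (P : ℕ → Set) : Set where
  field
    val     : ℕ
    holds   : P val
    minimal : ∀ j → j < val → ¬ P j
open Least

Least-map : ∀ {P Q : ℕ → Set} → (∀ {n} → P n → Q n) → (∀ {n} → Q n → P n) →
            Least P → Least Q
Least-map P⇒Q Q⇒P l = record
  { val = val l ; holds = P⇒Q (holds l) ; minimal = λ j j<l → minimal l j j<l ∘ Q⇒P }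

Least-unique : ∀ {P : ℕ → Set} (l l′ : Least P) → val l ≡ val l′
Least-unique l l′ with <-cmp (val l) (val l′)
... | tri< l<l′ _ _ = ⊥-elim (minimal l′ _ l<l′ (holds l))
... | tri≈ _ l≡l′ _ = l≡l′
... | tri> _ _ l′<l = ⊥-elim (minimal l _ l′<l (holds l′))

module _ {P : ℕ → Set} (P? : Decidable P) where

  private
    search : ∀ n → (∀ j → j < n → ¬ P j) ⊎ Least P
    search zero = inj₁ (λ _ ())
    search (suc n) with search n
    ... | inj₂ l = inj₂ l
    ... | inj₁ ¬P<n with P? n
    ...   | yes Pn = inj₂ (record { val = n ; holds = Pn ; minimal = ¬P<n })
    ...   | no ¬Pn = inj₁ λ j j<1+n → [ ¬P<n j , (λ { refl → ¬Pn }) ]′ (m<1+n⇒m<n∨m≡n j<1+n)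

  least : ∀ w → P w → Least P
  least w Pw with search (suc w)
  ... | inj₂ l     = l
  ... | inj₁ ¬P≤w = ⊥-elim (¬P≤w w ≤-refl Pw)

injective⇒unbounded : ∀ {f : ℕ → ℕ} → Injective _≡_ _≡_ f → ∀ n → ∃ λ m → n ≤ f m
injective⇒unbounded {f} f-inj n with anyUpTo? (λ m → n ≤? f m) (suc n)
... | yes (m , _ , n≤fm) = m , n≤fm
... | no ¬bounded        = ⊥-elim (1+n≰n (injective⇒≤ F-injective))
  where
  F : Fin (suc n) → Fin n
  F i = fromℕ< (≰⇒> λ n≤f → ¬bounded (toℕ i , toℕ<n i , n≤f))

  F-injective : Injective _≡_ _≡_ F
  F-injective {i} {j} Fi≡Fj = toℕ-injective (f-inj (begin
    f (toℕ i)   ≡⟨ toℕ-fromℕ< _ ⟨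
    toℕ (F i)   ≡⟨ cong toℕ Fi≡Fj ⟩
    toℕ (F j)   ≡⟨ toℕ-fromℕ< _ ⟩
    f (toℕ j)   ∎))

-- μ-recursive programs

record Program (n : ℕ) (f : Vec ℕ n → ℕ) : Set where
  constructor program
  field
    code    : MR n
    correct : ∀ xs → code ⇓[ xs ] f xs
open Program

program-cong : ∀ {n f g} → f ≗ g → Program n f → Program n g
program-cong f≗g (program c ok) = program c λ xs → subst (c ⇓[ xs ]_) (f≗g xs) (ok xs)

data Programs (n : ℕ) : ℕ → Set where
  []  : Programs n 0
  _∷_ : ∀ {k f} → Program n f → Programs n k → Programs n (suc k)

values : ∀ {n k} → Programs n k → Vec ℕ n → Vec ℕ k
values []                  xs = []
values (_∷_ {f = f} _ ps) xs = f xs ∷ values ps xs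

codes : ∀ {n k} → Programs n k → Vec (MR n) k
codes []       = []
codes (p ∷ ps) = code p ∷ codes ps

codes-correct : ∀ {n k} (ps : Programs n k) xs → codes ps ⇓*[ xs ] values ps xs
codes-correct []       xs = []⇓
codes-correct (p ∷ ps) xs = ∷⇓ (correct p xs) (codes-correct ps xs)

compose : ∀ {n k f} → Program k f → (ps : Programs n k) → Program n (f ∘ values ps)
compose p ps = program (comp (code p) (codes ps)) λ xs → comp⇓ (codes-correct ps xs) (correct p _)

var : ∀ {n} (i : Fin n) → Program n (λ xs → lookup xs i)
var i = program (proj i) λ _ → proj⇓

primRecFn : ∀ {n} → (Vec ℕ n → ℕ) → (Vec ℕ (suc (suc n)) → ℕ) → Vec ℕ (suc n) → ℕ
primRecFn g h (zero  ∷ xs) = g xs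
primRecFn g h (suc m ∷ xs) = h (m ∷ primRecFn g h (m ∷ xs) ∷ xs)

primRec : ∀ {n g h} → Program n g → Program (suc (suc n)) h → Program (suc n) (primRecFn g h)
primRec {g = g} {h} pg ph = program (prec (code pg) (code ph)) correct-prec
  where
  correct-prec : ∀ xs → prec (code pg) (code ph) ⇓[ xs ] primRecFn g h xs
  correct-prec (zero  ∷ xs) = prec0⇓ (correct pg xs)
  correct-prec (suc m ∷ xs) = precS⇓ (correct-prec (m ∷ xs)) (correct ph _)

minimise : ∀ {n c} → Program (suc n) c → (L : ∀ xs → Least (λ t → c (t ∷ xs) ≡ 0)) →
           Program n (λ xs → val (L xs))
minimise {c = c} p L = program (mu (code p)) λ xs →
  mu⇓ (subst (code p ⇓[ _ ]_) (holds (L xs)) (correct p _))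
      (λ j j<L → nonzero (minimal (L xs) j j<L) (correct p (j ∷ xs)))
  where
  nonzero : ∀ {ys v} → v ≢ 0 → code p ⇓[ ys ] v → ∃ λ k → code p ⇓[ ys ] suc k
  nonzero {v = zero}  v≢0 _ = ⊥-elim (v≢0 refl)
  nonzero {v = suc k} _   d = k , d

vars : ∀ {n k} → (Fin k → Fin n) → Programs n k
vars {k = zero}  σ = []
vars {k = suc k} σ = var (σ fzero) ∷ vars (σ ∘ fsuc)

values-vars : ∀ {n k} (σ : Fin k → Fin n) xs → values (vars σ) xs ≡ tabulate (lookup xs ∘ σ)
values-vars {k = zero}  σ xs = refl
values-vars {k = suc k} σ xs = cong (lookup xs (σ fzero) ∷_) (values-vars (σ ∘ fsuc) xs)

weaken : ∀ {n f} → Program n f → Program (suc n) (f ∘ tail)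
weaken {f = f} p = program-cong
  (λ { (x ∷ xs) → cong f (trans (values-vars fsuc (x ∷ xs)) (tabulate∘lookup xs)) })
  (compose p (vars fsuc))

record Program₁ (f : ℕ → ℕ) : Set where
  constructor program₁
  field
    unary : Program 1 (f ∘ head)
open Program₁

record Program₂ (f : ℕ → ℕ → ℕ) : Set where
  constructor program₂
  field
    binary : Program 2 (λ xs → f (head xs) (head (tail xs)))
open Program₂

app₁ : ∀ {n g} {f : ℕ → ℕ} → Program₁ f → Program n g → Program n (f ∘ g)
app₁ p q = compose (unary p) (q ∷ [])

app₂ : ∀ {n g h} {f : ℕ → ℕ → ℕ} → Program₂ f → Program n g → Program n h →
       Program n (λ xs → f (g xs) (h xs))
app₂ p q r = compose (binary p) (q ∷ r ∷ [])

mutual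
  toMR : ∀ {n} → PR n → MR n
  toMR zeroᶠ       = zeroᶠ
  toMR succᶠ       = succᶠ
  toMR (proj i)    = proj i
  toMR (comp f gs) = comp (toMR f) (toMR* gs)
  toMR (prec g h)  = prec (toMR g) (toMR h)

  toMR* : ∀ {k n} → Vec (PR n) k → Vec (MR n) k
  toMR* []       = []
  toMR* (g ∷ gs) = toMR g ∷ toMR* gs

mutual
  toMR-correct : ∀ {n} (c : PR n) xs → toMR c ⇓[ xs ] evalPR c xs
  toMR-correct zeroᶠ       []           = zero⇓
  toMR-correct succᶠ       (x ∷ [])     = succ⇓
  toMR-correct (proj i)    xs           = proj⇓
  toMR-correct (comp f gs) xs           = comp⇓ (toMR*-correct gs xs) (toMR-correct f _)
  toMR-correct (prec g h)  (zero ∷ xs)  = prec0⇓ (toMR-correct g xs)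
  toMR-correct (prec g h)  (suc m ∷ xs) = precS⇓ (toMR-correct (prec g h) (m ∷ xs)) (toMR-correct h _)

  toMR*-correct : ∀ {k n} (gs : Vec (PR n) k) xs → toMR* gs ⇓*[ xs ] evalPR* gs xs
  toMR*-correct []       xs = []⇓
  toMR*-correct (g ∷ gs) xs = ∷⇓ (toMR-correct g xs) (toMR*-correct gs xs)

primRec-program : ∀ {f} → IsPrimRec f → Program₁ f
primRec-program (c , c≗f) =
  program₁ (program-cong (λ { (x ∷ []) → c≗f x }) (program (toMR c) (toMR-correct c)))

Program₁⇒totalRec : ∀ {f} → Program₁ f → IsTotalRec f
Program₁⇒totalRec p = code (unary p) , λ x → correct (unary p) [ x ]

primRec⇒totalRec : ∀ {f} → IsPrimRec f → IsTotalRec f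
primRec⇒totalRec = Program₁⇒totalRec ∘ primRec-program

v₀ : ∀ {n} → Program (suc n) head
v₀ = program-cong (λ { (x ∷ xs) → refl }) (var fzero)

v₁ : ∀ {n} → Program (suc (suc n)) (head ∘ tail)
v₁ = weaken v₀

v₂ : ∀ {n} → Program (suc (suc (suc n))) (head ∘ tail ∘ tail)
v₂ = weaken v₁

iterate-program : ∀ {n g s} → Program n g → Program₁ s →
                  Program (suc n) (λ xs → fold (g (tail xs)) s (head xs))
iterate-program {g = g} {s} pg ps = program-cong primRecFn≗fold (primRec pg (app₁ ps v₁))
  where
  primRecFn≗fold : ∀ xs → primRecFn g (s ∘ head ∘ tail) xs ≡ fold (g (tail xs)) s (head xs)
  primRecFn≗fold (zero  ∷ xs) = refl
  primRecFn≗fold (suc m ∷ xs) = cong s (primRecFn≗fold (m ∷ xs))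

if0 : ℕ → ℕ → ℕ → ℕ
if0 zero    a b = a
if0 (suc _) a b = b

if0-program : ∀ {n d a b} → Program n d → Program n a → Program n b →
              Program n (λ xs → if0 (d xs) (a xs) (b xs))
if0-program {d = d} {a} {b} pd pa pb = program-cong
  (λ xs → cong (λ ys → if0 (d xs) (a ys) (b ys)) (trans (values-vars id xs) (tabulate∘lookup xs)))
  (compose branch (pd ∷ vars id))
  where
  branch : Program _ (λ xs → if0 (head xs) (a (tail xs)) (b (tail xs)))
  branch = program-cong (λ { (zero ∷ xs) → refl ; (suc _ ∷ xs) → refl })
                        (primRec pa (weaken (weaken pb)))

suc-program : Program₁ suc
suc-program = program₁ (program succᶠ λ { (x ∷ []) → succ⇓ })

const-program : ∀ {n} c → Program n (λ _ → c)
const-program zero    = compose {f = λ _ → 0} (program zeroᶠ λ { [] → zero⇓ }) []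
const-program (suc c) = app₁ suc-program (const-program c)

pred-program : Program₁ pred
pred-program = program₁ (program-cong (λ { (zero ∷ []) → refl ; (suc _ ∷ []) → refl })
                                      (primRec (const-program 0) v₀))

+-program : Program₂ _+_
+-program = program₂ (program-cong (λ { (m ∷ n ∷ []) → +-is-fold m })
                                   (iterate-program v₀ suc-program))

∸-program : Program₂ _∸_
∸-program = program₂ (program-cong (λ { (m ∷ n ∷ []) → fold-pred m n })
                                   (compose (iterate-program v₀ pred-program) (v₁ ∷ v₀ ∷ [])))
  where
  fold-pred : ∀ m n → fold m pred n ≡ m ∸ n
  fold-pred m zero    = refl
  fold-pred m (suc n) = trans (cong pred (fold-pred m n)) (pred[m∸n]≡m∸[1+n] m n)

minimise-≤ : ∀ {n a b} → Program n a → Program (suc n) b →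
             (L : ∀ xs → Least (λ t → a xs ≤ b (t ∷ xs))) → Program n (λ xs → val (L xs))
minimise-≤ pa pb L =
  minimise (app₂ ∸-program (weaken pa) pb) (λ xs → Least-map m≤n⇒m∸n≡0 m∸n≡0⇒m≤n (L xs))

-- Cantor pairing

tri : ℕ → ℕ
tri zero    = 0
tri (suc w) = tri w + suc w

tri-mono-≤ : ∀ {a b} → a ≤ b → tri a ≤ tri b
tri-mono-≤ z≤n       = z≤n
tri-mono-≤ (s≤s a≤b) = +-mono-≤ (tri-mono-≤ a≤b) (s≤s a≤b)

tri-program : Program₁ tri
tri-program = program₁ (program-cong primRecFn≗tri
  (primRec (const-program 0) (app₂ +-program v₁ (app₁ suc-program v₀))))
  where
  primRecFn≗tri : ∀ xs →
                  primRecFn (λ _ → 0) (λ ys → head (tail ys) + suc (head ys)) xs ≡ tri (head xs)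
  primRecFn≗tri (zero  ∷ []) = refl
  primRecFn≗tri (suc m ∷ []) = cong (_+ suc m) (primRecFn≗tri (m ∷ []))

pair : ℕ → ℕ → ℕ
pair a b = tri (a + b) + b

opaque
  diagonal : ∀ z → Least (λ w → suc z ≤ tri (suc w))
  diagonal z = least (λ w → suc z ≤? tri (suc w)) z (m≤n+m (suc z) (tri z))

diagonal-pair : ∀ a b → val (diagonal (pair a b)) ≡ a + b
diagonal-pair a b = Least-unique (diagonal (pair a b)) record
  { val     = a + b
  ; holds   = +-monoʳ-< (tri (a + b)) (s≤s (m≤n+m b a))
  ; minimal = λ j j<a+b lt → <⇒≱ lt (≤-trans (tri-mono-≤ j<a+b) (m≤m+n (tri (a + b)) b))
  }

snd : ℕ → ℕ
snd z = z ∸ tri (val (diagonal z))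

fst : ℕ → ℕ
fst z = val (diagonal z) ∸ snd z

snd-pair : ∀ a b → snd (pair a b) ≡ b
snd-pair a b rewrite diagonal-pair a b = m+n∸m≡n (tri (a + b)) b

fst-pair : ∀ a b → fst (pair a b) ≡ a
fst-pair a b rewrite snd-pair a b | diagonal-pair a b = m+n∸n≡m a b

pair-program : Program₂ pair
pair-program = program₂ (app₂ +-program (app₁ tri-program (app₂ +-program v₀ v₁)) v₁)

diagonal-program : Program₁ (val ∘ diagonal)
diagonal-program = program₁ (program-cong (λ { (z ∷ []) → refl })
  (minimise-≤ (app₁ suc-program v₀) (app₁ tri-program (app₁ suc-program v₀))
              (λ { (z ∷ []) → diagonal z })))

snd-program : Program₁ snd
snd-program = program₁ (app₂ ∸-program v₀ (app₁ tri-program (app₁ diagonal-program v₀)))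

fst-program : Program₁ fst
fst-program = program₁ (app₂ ∸-program (app₁ diagonal-program v₀) (app₁ snd-program v₀))

-- A stack machine for the Ackermann function

ack : ℕ → ℕ → ℕ
ack zero    n       = suc n
ack (suc m) zero    = ack m 1
ack (suc m) (suc n) = ack m (ack (suc m) n)

State : Set
State = List ℕ × ℕ

-- (m₁ ∷ ⋯ ∷ mₖ , n) stands for ack mₖ (⋯ (ack m₁ n)).
step : State → State
step ([]        , n)     = [] , n
step (zero  ∷ s , n)     = s , suc n
step (suc m ∷ s , zero)  = m ∷ s , 1
step (suc m ∷ s , suc n) = suc m ∷ m ∷ s , n

run : ℕ → State → State
run t st = fold st step t

run-halted : ∀ t n → run t ([] , n) ≡ ([] , n)
run-halted zero    n = refl
run-halted (suc t) n = cong step (run-halted t n)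

ack-halts : ∀ m n s → ∃ λ t → run t (m ∷ s , n) ≡ (s , ack m n)
ack-halts zero    n       s = 1 , refl
ack-halts (suc m) zero    s with ack-halts m 1 s
... | t , halts = t + 1 , trans (fold-+ _ step t) halts
ack-halts (suc m) (suc n) s with ack-halts (suc m) n (m ∷ s) | ack-halts m (ack (suc m) n) s
... | t₁ , halts₁ | t₂ , halts₂ = t₂ + (t₁ + 1) , (begin
  run (t₂ + (t₁ + 1)) (suc m ∷ s , suc n)       ≡⟨ fold-+ _ step t₂ ⟩
  run t₂ (run (t₁ + 1) (suc m ∷ s , suc n))     ≡⟨ cong (run t₂) (fold-+ _ step t₁) ⟩
  run t₂ (run t₁ (suc m ∷ m ∷ s , n))           ≡⟨ cong (run t₂) halts₁ ⟩
  run t₂ (m ∷ s , ack (suc m) n)                ≡⟨ halts₂ ⟩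
  (s , ack m (ack (suc m) n))                   ∎)

-- Halted states are fixed points of the machine, so a run halts in at most one state.
halted-unique : ∀ st t t′ {n} → run t st ≡ ([] , n) → proj₁ (run t′ st) ≡ [] →
                run t′ st ≡ ([] , n)
halted-unique st t t′ {n} halts halted′ with ≤-total t t′
... | inj₁ t≤t′ = begin
  run t′ st                    ≡⟨ cong (λ k → run k st) (m∸n+n≡m t≤t′) ⟨
  run (t′ ∸ t + t) st          ≡⟨ fold-+ st step (t′ ∸ t) ⟩
  run (t′ ∸ t) (run t st)      ≡⟨ cong (run (t′ ∸ t)) halts ⟩
  run (t′ ∸ t) ([] , n)        ≡⟨ run-halted (t′ ∸ t) n ⟩
  ([] , n)                     ∎
... | inj₂ t′≤t with run t′ st in eq
...   | [] , n′ = begin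
  ([] , n′)                    ≡⟨ run-halted (t ∸ t′) n′ ⟨
  run (t ∸ t′) ([] , n′)       ≡⟨ cong (run (t ∸ t′)) eq ⟨
  run (t ∸ t′) (run t′ st)     ≡⟨ fold-+ st step (t ∸ t′) ⟨
  run (t ∸ t′ + t′) st         ≡⟨ cong (λ k → run k st) (m∸n+n≡m t′≤t) ⟩
  run t st                     ≡⟨ halts ⟩
  ([] , n)                     ∎
...   | _ ∷ _ , _ with () ← halted′

encodeStack : List ℕ → ℕ
encodeStack []      = 0
encodeStack (m ∷ s) = suc (pair m (encodeStack s))

encode : State → ℕ
encode (s , n) = pair (encodeStack s) n

fst-encode≡0⇒halted : ∀ st → fst (encode st) ≡ 0 → proj₁ st ≡ []
fst-encode≡0⇒halted ([] , n) _ = refl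
fst-encode≡0⇒halted (m ∷ s , n) eq with () ← trans (sym (fst-pair (encodeStack (m ∷ s)) n)) eq

stepCons : ℕ → ℕ → ℕ → ℕ
stepCons zero    s n       = pair s (suc n)
stepCons (suc m) s zero    = pair (suc (pair m s)) 1
stepCons (suc m) s (suc n) = pair (suc (pair (suc m) (suc (pair m s)))) n

stepᴺ : ℕ → ℕ
stepᴺ z = if0 (fst z) z (stepCons (fst (pred (fst z))) (snd (pred (fst z))) (snd z))

stepᴺ-encode : ∀ st → stepᴺ (encode st) ≡ encode (step st)
stepᴺ-encode ([] , n) rewrite fst-pair 0 n = refl
stepᴺ-encode (m ∷ s , n)
  rewrite fst-pair (encodeStack (m ∷ s)) n | snd-pair (encodeStack (m ∷ s)) n
        | fst-pair m (encodeStack s) | snd-pair m (encodeStack s) = stepCons-encode m n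
  where
  stepCons-encode : ∀ m n → stepCons m (encodeStack s) n ≡ encode (step (m ∷ s , n))
  stepCons-encode zero    n       = refl
  stepCons-encode (suc m) zero    = refl
  stepCons-encode (suc m) (suc n) = refl

runᴺ : ℕ → ℕ → ℕ
runᴺ t z = fold z stepᴺ t

runᴺ-encode : ∀ t st → runᴺ t (encode st) ≡ encode (run t st)
runᴺ-encode zero    st = refl
runᴺ-encode (suc t) st = trans (cong stepᴺ (runᴺ-encode t st)) (stepᴺ-encode (run t st))

stepCons-program : Program 3 (λ xs → stepCons (head xs) (head (tail xs)) (head (tail (tail xs))))
stepCons-program = program-cong
  (λ { (zero  ∷ s ∷ n     ∷ []) → refl
      ; (suc m ∷ s ∷ zero  ∷ []) → refl
      ; (suc m ∷ s ∷ suc n ∷ []) → refl })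
  (if0-program v₀ (app₂ pair-program v₁ (app₁ suc-program v₂))
    (if0-program v₂ (app₂ pair-program (app₁ suc-program pair[m-1,s]) (const-program 1))
      (app₂ pair-program (app₁ suc-program (app₂ pair-program v₀ (app₁ suc-program pair[m-1,s])))
                         (app₁ pred-program v₂))))
  where
  pair[m-1,s] : Program 3 (λ xs → pair (pred (head xs)) (head (tail xs)))
  pair[m-1,s] = app₂ pair-program (app₁ pred-program v₀) v₁

stepᴺ-program : Program₁ stepᴺ
stepᴺ-program = program₁ (if0-program stack v₀
  (compose stepCons-program
           (app₁ fst-program top ∷ app₁ snd-program top ∷ app₁ snd-program v₀ ∷ [])))
  where
  stack : Program 1 (fst ∘ head)
  stack = app₁ fst-program v₀
  top : Program 1 (pred ∘ fst ∘ head)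
  top = app₁ pred-program stack

runᴺ-program : Program₂ runᴺ
runᴺ-program = program₂ (iterate-program v₀ stepᴺ-program)

HaltsWith : State → ℕ → Set
HaltsWith st n = ∃ λ t → run t st ≡ ([] , n)

halting-time : ∀ {st n} → HaltsWith st n → Least (λ t → fst (runᴺ t (encode st)) ≡ 0)
halting-time {st} {n} (t , halts) = least (λ t → fst (runᴺ t (encode st)) ≟ 0) t (begin
  fst (runᴺ t (encode st))   ≡⟨ cong fst (runᴺ-encode t st) ⟩
  fst (encode (run t st))    ≡⟨ cong (fst ∘ encode) halts ⟩
  fst (pair 0 n)             ≡⟨ fst-pair 0 n ⟩
  0                          ∎)

run-halting-time : ∀ {st n} (h : HaltsWith st n) → run (val (halting-time h)) st ≡ ([] , n)
run-halting-time {st} h = halted-unique st (proj₁ h) t (proj₂ h) (fst-encode≡0⇒halted (run t st)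
  (trans (cong fst (sym (runᴺ-encode t st))) (holds (halting-time h))))
  where
  t : ℕ
  t = val (halting-time h)

initial-program : ∀ {n f g} → Program n f → Program n g →
                  Program n (λ xs → encode (f xs ∷ [] , g xs))
initial-program pm pn =
  app₂ pair-program (app₁ suc-program (app₂ pair-program pm (const-program 0))) pn

ack-program : Program₂ ack
ack-program = program₂ (program-cong result
  (app₁ snd-program (app₂ runᴺ-program (minimise halted (λ xs → halting-time (ack-halts′ xs)))
                                      (initial-program v₀ v₁))))
  where
  ack-halts′ : ∀ xs → HaltsWith (head xs ∷ [] , head (tail xs)) (ack (head xs) (head (tail xs)))
  ack-halts′ xs = ack-halts (head xs) (head (tail xs)) []

  halted : Program 3 (λ xs → fst (runᴺ (head xs) (encode (head (tail xs) ∷ [] , head (tail (tail xs))))))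
  halted = app₁ fst-program (app₂ runᴺ-program v₀ (initial-program v₁ v₂))

  result : ∀ xs → snd (runᴺ (val (halting-time (ack-halts′ xs))) (encode (head xs ∷ [] , head (tail xs))))
                  ≡ ack (head xs) (head (tail xs))
  result xs@(m ∷ n ∷ []) = begin
    snd (runᴺ t (encode (m ∷ [] , n)))  ≡⟨ cong snd (runᴺ-encode t (m ∷ [] , n)) ⟩
    snd (encode (run t (m ∷ [] , n)))   ≡⟨ cong (snd ∘ encode) (run-halting-time (ack-halts′ xs)) ⟩
    snd (pair 0 (ack m n))              ≡⟨ snd-pair 0 (ack m n) ⟩
    ack m n                             ∎
    where
    t : ℕ
    t = val (halting-time (ack-halts′ xs))

-- Majorisation of primitive recursive functions by the Ackermann function

n<ack : ∀ m n → n < ack m n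
n<ack zero    n       = n<1+n n
n<ack (suc m) zero    = <-trans z<s (n<ack m 1)
n<ack (suc m) (suc n) = ≤-<-trans (n<ack (suc m) n) (n<ack m (ack (suc m) n))

ack-monoʳ-<-suc : ∀ m n → ack m n < ack m (suc n)
ack-monoʳ-<-suc zero    n = n<1+n (suc n)
ack-monoʳ-<-suc (suc m) n = n<ack m (ack (suc m) n)

ack-monoʳ-≤ : ∀ m {n n′} → n ≤ n′ → ack m n ≤ ack m n′
ack-monoʳ-≤ m n≤n′ = go (≤⇒≤′ n≤n′)
  where
  go : ∀ {n n′} → n ≤′ n′ → ack m n ≤ ack m n′
  go (≤′-reflexive refl) = ≤-refl
  go (≤′-step n≤′n′)     = ≤-trans (go n≤′n′) (<⇒≤ (ack-monoʳ-<-suc m _))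

ack-monoʳ-< : ∀ m {n n′} → n < n′ → ack m n < ack m n′
ack-monoʳ-< m {n} n<n′ = <-≤-trans (ack-monoʳ-<-suc m n) (ack-monoʳ-≤ m n<n′)

ack[m,1+n]≤ack[1+m,n] : ∀ m n → ack m (suc n) ≤ ack (suc m) n
ack[m,1+n]≤ack[1+m,n] m zero    = ≤-refl
ack[m,1+n]≤ack[1+m,n] m (suc n) = ack-monoʳ-≤ m (≤-trans (n<ack m (suc n)) (ack[m,1+n]≤ack[1+m,n] m n))

ack-monoˡ-<-suc : ∀ m n → ack m n < ack (suc m) n
ack-monoˡ-<-suc m n = <-≤-trans (ack-monoʳ-<-suc m n) (ack[m,1+n]≤ack[1+m,n] m n)

ack-monoˡ-≤ : ∀ {m m′} n → m ≤ m′ → ack m n ≤ ack m′ n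
ack-monoˡ-≤ n m≤m′ = go (≤⇒≤′ m≤m′)
  where
  go : ∀ {m m′} → m ≤′ m′ → ack m n ≤ ack m′ n
  go (≤′-reflexive refl) = ≤-refl
  go (≤′-step m≤′m′)     = ≤-trans (go m≤′m′) (<⇒≤ (ack-monoˡ-<-suc _ n))

ack[m,ack[m,n]]<ack[2+m,n] : ∀ m n → ack m (ack m n) < ack (suc (suc m)) n
ack[m,ack[m,n]]<ack[2+m,n] m n =
  <-≤-trans (ack-monoʳ-< m (ack-monoˡ-<-suc m n)) (ack[m,1+n]≤ack[1+m,n] (suc m) n)

ack[1,n]≡2+n : ∀ n → ack 1 n ≡ suc (suc n)
ack[1,n]≡2+n zero    = refl
ack[1,n]≡2+n (suc n) = cong suc (ack[1,n]≡2+n n)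

n+n<ack[2,n] : ∀ n → n + n < ack 2 n
n+n<ack[2,n] zero = z<s
n+n<ack[2,n] (suc n) rewrite ack[1,n]≡2+n (ack 2 n) | +-suc n n = s<s (s<s (n+n<ack[2,n] n))

ack-mono-≤ : ∀ {m m′ n n′} → m ≤ m′ → n ≤ n′ → ack m n ≤ ack m′ n′
ack-mono-≤ {m′ = m′} {n} m≤m′ n≤n′ = ≤-trans (ack-monoˡ-≤ n m≤m′) (ack-monoʳ-≤ m′ n≤n′)

ack-compose : ∀ k K M {v} → v ≤ ack K M → ack k v < ack (suc (suc (k ⊔ K))) M
ack-compose k K M v≤ack = ≤-<-trans
  (ack-mono-≤ (m≤m⊔n k K) (≤-trans v≤ack (ack-monoˡ-≤ M (m≤n⊔m k K))))
  (ack[m,ack[m,n]]<ack[2+m,n] (k ⊔ K) M)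

maximum : ∀ {n} → Vec ℕ n → ℕ
maximum []       = 0
maximum (x ∷ xs) = x ⊔ maximum xs

lookup≤maximum : ∀ {n} (xs : Vec ℕ n) i → lookup xs i ≤ maximum xs
lookup≤maximum (x ∷ xs) fzero    = m≤m⊔n x (maximum xs)
lookup≤maximum (x ∷ xs) (fsuc i) = ≤-trans (lookup≤maximum xs i) (m≤n⊔m x (maximum xs))

MajorisedBy : ∀ {n} → (Vec ℕ n → ℕ) → ℕ → Set
MajorisedBy f k = ∀ xs → f xs < ack k (maximum xs)

Majorised : ∀ {n} → (Vec ℕ n → ℕ) → Set
Majorised f = ∃ (MajorisedBy f)

-- ack (1 + K) (1 + m + M) unfolds to ack K (ack (1 + K) (m + M)), absorbing one application of h.
prec-majorised : ∀ {n} {g : PR n} {h} kg kh → MajorisedBy (evalPR g) kg → MajorisedBy (evalPR h) kh →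
                 ∀ m xs → evalPR (prec g h) (m ∷ xs) < ack (suc (kg ⊔ kh)) (m + maximum xs)
prec-majorised kg kh g< h< zero xs =
  <-≤-trans (g< xs) (<⇒≤ (<-≤-trans (ack-monoˡ-<-suc kg M) (ack-monoˡ-≤ M (s≤s (m≤m⊔n kg kh)))))
  where
  M : ℕ
  M = maximum xs
prec-majorised {g = g} {h} kg kh g< h< (suc m) xs =
  <-≤-trans (h< (m ∷ r ∷ xs)) (ack-mono-≤ (m≤n⊔m kg kh) (⊔-lub m≤ (⊔-lub r≤ M≤)))
  where
  r M K : ℕ
  r = evalPR (prec g h) (m ∷ xs)
  M = maximum xs
  K = suc (kg ⊔ kh)
  m≤ : m ≤ ack K (m + M)
  m≤ = <⇒≤ (≤-<-trans (m≤m+n m M) (n<ack K (m + M)))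
  r≤ : r ≤ ack K (m + M)
  r≤ = <⇒≤ (prec-majorised kg kh g< h< m xs)
  M≤ : M ≤ ack K (m + M)
  M≤ = <⇒≤ (≤-<-trans (m≤n+m M m) (n<ack K (m + M)))

mutual
  primRec-majorised : ∀ {n} (c : PR n) → Majorised (evalPR c)
  primRec-majorised zeroᶠ    = 0 , λ { [] → z<s }
  primRec-majorised succᶠ    = 1 , λ { (x ∷ []) →
    ≤-reflexive (sym (trans (ack[1,n]≡2+n (x ⊔ 0)) (cong (suc ∘ suc) (⊔-identityʳ x)))) }
  primRec-majorised (proj i) = 0 , λ xs → s≤s (lookup≤maximum xs i)
  primRec-majorised (comp f gs) with primRec-majorised f | primRecs-majorised gs
  ... | k , f< | K , gs< = suc (suc (k ⊔ K)) , λ xs →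
    <-trans (f< (evalPR* gs xs)) (ack-compose k K (maximum xs) (<⇒≤ (gs< xs)))
  primRec-majorised (prec g h) with primRec-majorised g | primRec-majorised h
  ... | kg , g< | kh , h< = suc (suc (suc (kg ⊔ kh) ⊔ 2)) , λ { (m ∷ xs) →
    <-≤-trans (prec-majorised kg kh g< h< m xs) (<⇒≤ (ack-compose (suc (kg ⊔ kh)) 2 (m ⊔ maximum xs)
      (<⇒≤ (≤-<-trans (+-mono-≤ (m≤m⊔n m (maximum xs)) (m≤n⊔m m (maximum xs)))
                      (n+n<ack[2,n] (m ⊔ maximum xs)))))) }

  primRecs-majorised : ∀ {k n} (gs : Vec (PR n) k) → Majorised (maximum ∘ evalPR* gs)
  primRecs-majorised []       = 0 , λ xs → z<s
  primRecs-majorised (g ∷ gs) with primRec-majorised g | primRecs-majorised gs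
  ... | k , g< | K , gs< = k ⊔ K , λ xs →
    ⊔-lub (≤-trans (g< xs) (ack-monoˡ-≤ _ (m≤m⊔n k K)))
          (≤-trans (gs< xs) (ack-monoˡ-≤ _ (m≤n⊔m k K)))

¬primRec-dominates-ack : ∀ {f} → IsPrimRec f → ¬ (∀ x → ack x x ≤ f x)
¬primRec-dominates-ack (c , c≗f) ack≤f with primRec-majorised c
... | k , c< = <⇒≱ (subst₂ _<_ (c≗f k) (cong (ack k) (⊔-identityʳ k)) (c< [ k ])) (ack≤f k)

primRec-cong : ∀ {f g} → f ≗ g → IsPrimRec f → IsPrimRec g
primRec-cong f≗g (c , c≗f) = c , λ x → trans (c≗f x) (f≗g x)

∘-primRec : ∀ {f g} → IsPrimRec f → IsPrimRec g → IsPrimRec (f ∘ g)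
∘-primRec (c , c≗f) (d , d≗g) =
  comp c (d ∷ []) , λ x → trans (cong (λ y → evalPR c [ y ]) (d≗g x)) (c≗f _)

constPR : ℕ → PR 0
constPR zero    = zeroᶠ
constPR (suc v) = comp succᶠ (constPR v ∷ [])

constPR-correct : ∀ v → evalPR (constPR v) [] ≡ v
constPR-correct zero    = refl
constPR-correct (suc v) = cong suc (constPR-correct v)

iteration-primRec : ∀ {ρ f} → IsPrimRec f → f ∘ ρ ≗ ρ ∘ suc → IsPrimRec ρ
iteration-primRec {ρ} {f} (c , c≗f) f∘ρ≗ρ∘suc = cρ , cρ≗ρ
  where
  cρ : PR 1
  cρ = prec (constPR (ρ 0)) (comp c (proj (fsuc fzero) ∷ []))

  cρ≗ρ : ∀ x → evalPR cρ [ x ] ≡ ρ x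
  cρ≗ρ zero    = constPR-correct (ρ 0)
  cρ≗ρ (suc x) = begin
    evalPR c [ evalPR cρ [ x ] ]   ≡⟨ c≗f _ ⟩
    f (evalPR cρ [ x ])            ≡⟨ cong f (cρ≗ρ x) ⟩
    f (ρ x)                        ≡⟨ f∘ρ≗ρ∘suc x ⟩
    ρ (suc x)                      ∎

simulation-conjugate : ∀ {ρ} → SimulatesVia Prim Rec ρ → ∀ {g} → IsTotalRec g →
                       ∃ λ f → IsPrimRec f × (f ∘ ρ ≗ ρ ∘ g)
simulation-conjugate {ρ} sim {g} g-totalRec with sim (just ∘ g) (g , g-totalRec , λ _ → refl)
... | _ , (f , f-primRec , f′≗f) , ρ∘g≗f′∘ρ =
  f , f-primRec , λ x → just-injective (trans (sym (f′≗f (ρ x))) (sym (ρ∘g≗f′∘ρ x)))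

simulation-encoding-primRec : ∀ {ρ} → SimulatesVia Prim Rec ρ → IsPrimRec ρ
simulation-encoding-primRec sim
  with simulation-conjugate sim {suc} (primRec⇒totalRec (succᶠ , λ _ → refl))
... | f , f-primRec , f∘ρ≗ρ∘suc = iteration-primRec f-primRec f∘ρ≗ρ∘suc

simulation-∘-primRec : ∀ {ρ g} → SimulatesVia Prim Rec ρ → IsTotalRec g → IsPrimRec (ρ ∘ g)
simulation-∘-primRec sim g-totalRec with simulation-conjugate sim g-totalRec
... | f , f-primRec , f∘ρ≗ρ∘g =
  primRec-cong f∘ρ≗ρ∘g (∘-primRec f-primRec (simulation-encoding-primRec sim))

module _ {ρ : ℕ → ℕ} (ρ-injective : Injective _≡_ _≡_ ρ) (ρ-primRec : IsPrimRec ρ) where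

  pursuit : ∀ x → Least (λ m → ack x x ≤ ρ m)
  pursuit x with injective⇒unbounded ρ-injective (ack x x)
  ... | m , ack≤ρm = least (λ m → ack x x ≤? ρ m) m ack≤ρm

  pursuit-totalRec : IsTotalRec (val ∘ pursuit)
  pursuit-totalRec = Program₁⇒totalRec (program₁
    (minimise-≤ (app₂ ack-program v₀ v₀) (app₁ (primRec-program ρ-primRec) v₀) (pursuit ∘ head)))

¬Prim≿Rec : ¬ Simulates Prim Rec
¬Prim≿Rec (ρ , ρ-injective , sim) =
  ¬primRec-dominates-ack (simulation-∘-primRec sim (pursuit-totalRec ρ-injective ρ-primRec))
                         (holds ∘ pursuit ρ-injective ρ-primRec)
  where
  ρ-primRec : IsPrimRec ρ
  ρ-primRec = simulation-encoding-primRec sim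

ext-id : ∀ {D : Set} (m : Maybe D) → ext id m ≡ m
ext-id (just x) = refl
ext-id nothing  = refl

Rec≿Prim : Simulates Rec Prim
Rec≿Prim = id , id , λ g (f , f-primRec , g≗f) →
  g , (f , primRec⇒totalRec f-primRec , g≗f) , ext-id ∘ g

mainTheorem1 : StrictlySimulates Rec Prim
mainTheorem1 = Rec≿Prim , ¬Prim≿Rec
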